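{- Let $\mathbb{G}$ and $\mathbb{H}$ be finite graphs. If there is a graph homomorphism from $\mathbb{G}$ to $\mathbb{H}$, then $\Sigma_{\mathbb{H}}$ implies $\Sigma_{\mathbb{G}}$.
   Context: Graphs are structures $(V,E)$ with $E\subseteq V^2$ symmetric. For a finite graph $\mathbb{G}=(V,E)$, $\Sigma_{\mathbb{G}}$ is the height 1 condition with a ternary function symbol $f_v$ for each $v\in V$ and a 6-ary symbol $g_{(u,v)}$ for each $(u,v)\in E$, consisting of the identities $f_u(x,y,z)\approx g_{(u,v)}(x,y,x,z,y,z)$ and $f_v(x,y,z)\approx g_{(u,v)}(y,x,z,x,z,y)$ (universally quantified) for all $(u,v)\in E$. A clone satisfies such a condition if the symbols can be interpreted by functions of the clone of matching arities so that all identities hold. A condition $\Sigma$ implies $\Sigma'$ if every clone satisfying $\Sigma$ also satisfies $\Sigma'$. -}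

module Defs where

open import Level using (Level; _⊔_; suc)
open import Data.Nat using (ℕ)
open import Data.Fin using (Fin)
open import Data.Bool using (Bool; true)
open import Data.Product using (Σ; Σ-syntax; _×_)
open import Data.Vec.Functional using ([]; _∷_)
open import Relation.Binary.PropositionalEquality using (_≡_)

-- A finite graph: vertex set Fin size, edge relation given as a Boolean
-- matrix (so each edge is a single, proof-irrelevant index), symmetric.
record Graph : Set where
  field
    size : ℕ
    E    : Fin size → Fin size → Bool
    sym  : ∀ u v → E u v ≡ true → E v u ≡ true

open Graph public

Hom : Graph → Graph → Set
Hom G H = Σ[ h ∈ (Fin (size G) → Fin (size H)) ]
            (∀ u v → E G u v ≡ true → E H (h u) (h v) ≡ true)

Op : ∀ {a} → Set a → ℕ → Set a
Op A n = (Fin n → A) → A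

record Clone {a} (A : Set a) (ℓ : Level) : Set (a ⊔ suc ℓ) where
  field
    member : ∀ {n} → Op A n → Set ℓ
    proj : ∀ n (i : Fin n) → member (λ (x : Fin n → A) → x i)
    comp : ∀ n m (f : Op A n) (gs : Fin n → Op A m) →
           member f → (∀ i → member (gs i)) → member (λ x → f (λ i → gs i x))

open Clone public

Satisfies : ∀ {a ℓ} {A : Set a} → Clone A ℓ → Graph → Set (a ⊔ ℓ)
Satisfies {A = A} C G =
  Σ[ f ∈ (Fin (size G) → Op A 3) ]
  Σ[ g ∈ ((u v : Fin (size G)) → E G u v ≡ true → Op A 6) ]
    (∀ u → member C (f u))
  × (∀ u v e → member C (g u v e))
  × (∀ u v e (x y z : A) →
       f u (x ∷ y ∷ z ∷ []) ≡ g u v e (x ∷ y ∷ x ∷ z ∷ y ∷ z ∷ []))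
  × (∀ u v e (x y z : A) →
       f v (x ∷ y ∷ z ∷ []) ≡ g u v e (y ∷ x ∷ z ∷ x ∷ z ∷ y ∷ []))

Implies : ∀ a ℓ → Graph → Graph → Set (suc a ⊔ suc ℓ)
Implies a ℓ H G = (A : Set a) (C : Clone A ℓ) → Satisfies C H → Satisfies C G

module Submission where

open import Defs
open import Level using (Level)
open import Data.Product using (_,_)

-- Interpret f_u as f_(h u) and g_(u,v) as g_(h u,h v); the identities of Σ_G
-- are then instances of those of Σ_H, since h maps edges to edges.
satisfies-pullback : ∀ {a ℓ} {A : Set a} (C : Clone A ℓ) (G H : Graph) →
                     Hom G H → Satisfies C H → Satisfies C G
satisfies-pullback C G H (h , preserves) (f , g , f∈C , g∈C , fg-left , fg-right) =
  (λ u → f (h u)) ,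
  (λ u v e → g (h u) (h v) (preserves u v e)) ,
  (λ u → f∈C (h u)) ,
  (λ u v e → g∈C (h u) (h v) (preserves u v e)) ,
  (λ u v e → fg-left (h u) (h v) (preserves u v e)) ,
  (λ u v e → fg-right (h u) (h v) (preserves u v e))

lemma3p1 : ∀ {a ℓ : Level} (G H : Graph) → Hom G H → Implies a ℓ H G
lemma3p1 G H hom A C = satisfies-pullback C G H hom
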